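{- Let $d>7$ be a positive integer relatively prime to $3$, $5$ and $7$, and let $n$ be a positive integer. Then the number of primes in the set $\{d+1,2d+1,3d+1,\dots,nd+1\}$ is at most $0.46n+7$. -}

module Defs where

open import Data.Nat using (ℕ; zero; suc; _+_; _*_)
open import Data.Nat.Primality using (prime?)
open import Relation.Nullary.Decidable using (does)
open import Data.Bool using (if_then_else_)

primeCount : ℕ → ℕ → ℕ
primeCount d zero = 0
primeCount d (suc n) =
  (if does (prime? (suc n * d + 1)) then 1 else 0) + primeCount d n

-- A prime k d + 1 > 7 is divisible by none of 3, 5, 7. Whether k d + 1 avoids these three primes
-- depends only on the residues of d modulo 3, 5, 7 and is 105-periodic in k; when d is prime to 105
-- exactly 2 · 4 · 6 = 48 of every 105 consecutive k survive, and 48 / 105 < 0.46. So the prime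
-- count is bounded by a periodic sieve count, and a computation over one period for each of the
-- 48 residue triples gives the bound for all n.
module Submission where

open import Defs
open import Data.Bool using (Bool; true; false; not; _∧_; if_then_else_; T)
open import Data.Bool.Properties using (T-∧)
open import Data.Empty using (⊥-elim)
open import Data.Nat using (ℕ; zero; suc; _+_; _*_; _<_; _≤_; _%_; _/_; _≡ᵇ_; _≤?_; _<?_; z≤n; s≤s; NonZero; NonTrivial; nonTrivial⇒n>1)
open import Data.Nat.Coprimality using (Coprime)
open import Data.Nat.Divisibility using (∣-refl; m%n≡0⇒n∣m)
open import Data.Nat.DivMod using ([m+kn]%n≡m%n; m≡m%n+[m/n]*n; m%n<n)
open import Data.Nat.Primality using (Prime; prime?; composite)
open import Data.Nat.Properties
open import Data.Nat.Tactic.RingSolver using (solve)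
open import Data.List.Base using (_∷_; [])
open import Data.Product using (_×_; _,_)
open import Data.Unit using (tt)
open import Function.Bundles using (Equivalence)
open import Relation.Nullary.Decidable using (Dec; yes; does; _×-dec_; _→-dec_; toWitness)
open import Relation.Binary.PropositionalEquality

count : (ℕ → Bool) → ℕ → ℕ
count f zero    = 0
count f (suc n) = (if f (suc n) then 1 else 0) + count f n

primeCount≡count : ∀ d n → primeCount d n ≡ count (λ k → does (prime? (k * d + 1))) n
primeCount≡count d zero    = refl
primeCount≡count d (suc n) =
  cong ((if does (prime? (suc n * d + 1)) then 1 else 0) +_) (primeCount≡count d n)

count-mono : ∀ {f g} → (∀ k → T (f (suc k)) → T (g (suc k))) → ∀ n → count f n ≤ count g n
count-mono f⇒g zero    = z≤n
count-mono f⇒g (suc n) = indicator-mono (f⇒g n) (count-mono f⇒g n)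
  where
  indicator-mono : ∀ {x y i j} → (T x → T y) → i ≤ j → (if x then 1 else 0) + i ≤ (if y then 1 else 0) + j
  indicator-mono {false} {false} _ i≤j = i≤j
  indicator-mono {false} {true}  _ i≤j = m≤n⇒m≤1+n i≤j
  indicator-mono {true}  {false} x⇒y _ = ⊥-elim (x⇒y tt)
  indicator-mono {true}  {true}  _ i≤j = s≤s i≤j

Periodic : (ℕ → Bool) → ℕ → Set
Periodic f p = ∀ k → f (k + p) ≡ f k

count-+-period : ∀ {f p} → Periodic f p → ∀ n → count f (n + p) ≡ count f n + count f p
count-+-period         per zero    = refl
count-+-period {f} {p} per (suc n) = begin
  (if f (suc n + p) then 1 else 0) + count f (n + p)
    ≡⟨ cong₂ _+_ (cong (λ b → if b then 1 else 0) (per (suc n))) (count-+-period per n) ⟩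
  (if f (suc n) then 1 else 0) + (count f n + count f p)
    ≡⟨ +-assoc _ (count f n) (count f p) ⟨
  count f (suc n) + count f p
    ∎
  where open ≡-Reasoning

periodic⇒count-bound : ∀ {f} p .{{_ : NonZero p}} {A B C} → Periodic f p →
  A * count f p ≤ B * p → (∀ {n} → n < p → A * count f n ≤ B * n + C) →
  ∀ n → A * count f n ≤ B * n + C
periodic⇒count-bound {f} p {A} {B} {C} per period-bound initial-bound n =
  subst Bounded (sym (m≡m%n+[m/n]*n n p)) (bounded-after (n / p) (m%n<n n p))
  where
  Bounded : ℕ → Set
  Bounded m = A * count f m ≤ B * m + C

  bounded-+-period : ∀ m → Bounded m → Bounded (m + p)
  bounded-+-period m bounded = begin
    A * count f (m + p)              ≡⟨ cong (A *_) (count-+-period per m) ⟩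
    A * (count f m + count f p)      ≡⟨ *-distribˡ-+ A (count f m) (count f p) ⟩
    A * count f m + A * count f p    ≤⟨ +-mono-≤ bounded period-bound ⟩
    B * m + C + B * p                ≡⟨ solve (B ∷ m ∷ C ∷ p ∷ []) ⟩
    B * (m + p) + C                  ∎
    where open ≤-Reasoning

  bounded-after : ∀ q {r} → r < p → Bounded (r + q * p)
  bounded-after zero    {r} r<p = subst Bounded (sym (+-identityʳ r)) (initial-bound r<p)
  bounded-after (suc q) {r} r<p =
    subst Bounded (trans (+-assoc r (q * p) p) (cong (r +_) (+-comm (q * p) p)))
      (bounded-+-period (r + q * p) (bounded-after q r<p))

_∤ᵇ_ : (m : ℕ) .{{_ : NonZero m}} → ℕ → Bool
m ∤ᵇ x = not (x % m ≡ᵇ 0)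

∤ᵇ-+-* : ∀ m .{{_ : NonZero m}} x q → m ∤ᵇ (x + q * m) ≡ m ∤ᵇ x
∤ᵇ-+-* m x q = cong (λ r → not (r ≡ᵇ 0)) ([m+kn]%n≡m%n x q m)

∤ᵇ-residue : ∀ m .{{_ : NonZero m}} k d → m ∤ᵇ (k * d + 1) ≡ m ∤ᵇ (k * (d % m) + 1)
∤ᵇ-residue m k d = begin
  m ∤ᵇ (k * d + 1)                          ≡⟨ cong (λ e → m ∤ᵇ (k * e + 1)) (m≡m%n+[m/n]*n d m) ⟩
  m ∤ᵇ (k * (d % m + d / m * m) + 1)        ≡⟨ cong (m ∤ᵇ_) (regroup (d % m) (d / m)) ⟩
  m ∤ᵇ (k * (d % m) + 1 + k * (d / m) * m)  ≡⟨ ∤ᵇ-+-* m (k * (d % m) + 1) (k * (d / m)) ⟩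
  m ∤ᵇ (k * (d % m) + 1)                    ∎
  where
  open ≡-Reasoning
  regroup : ∀ r q → k * (r + q * m) + 1 ≡ k * r + 1 + k * q * m
  regroup r q = solve (k ∷ r ∷ q ∷ m ∷ [])

prime⇒∤ᵇ : ∀ m .{{_ : NonZero m}} {{_ : NonTrivial m}} {p} → m < p → Prime p → T (m ∤ᵇ p)
prime⇒∤ᵇ m {p} m<p p-prime with p % m in p%m≡r
... | zero  = Prime.notComposite p-prime (composite m<p (m%n≡0⇒n∣m p m p%m≡r))
... | suc _ = tt

coprime⇒%-positive : ∀ d m .{{_ : NonZero m}} {{_ : NonTrivial m}} → Coprime d m → 0 < d % m
coprime⇒%-positive d m coprime with d % m in d%m≡r
... | suc _ = s≤s z≤n
... | zero  = ⊥-elim (<-irrefl (sym (coprime (m%n≡0⇒n∣m d m d%m≡r , ∣-refl))) (nonTrivial⇒n>1 m))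

-- Marks the k for which k d + 1 is prime to 105, where d ≡ a, b, c modulo 3, 5, 7.
sieve : ℕ → ℕ → ℕ → ℕ → Bool
sieve a b c k = (3 ∤ᵇ (k * a + 1)) ∧ (5 ∤ᵇ (k * b + 1)) ∧ (7 ∤ᵇ (k * c + 1))

sieve-periodic : ∀ a b c → Periodic (sieve a b c) 105
sieve-periodic a b c k = cong₂ _∧_ (affine-periodic 3 35 a) (cong₂ _∧_ (affine-periodic 5 21 b) (affine-periodic 7 15 c))
  where
  affine-periodic : ∀ m .{{_ : NonZero m}} q e → m ∤ᵇ ((k + q * m) * e + 1) ≡ m ∤ᵇ (k * e + 1)
  affine-periodic m q e = trans (cong (m ∤ᵇ_) regroup) (∤ᵇ-+-* m (k * e + 1) (q * e))
    where
    regroup : (k + q * m) * e + 1 ≡ k * e + 1 + q * e * m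
    regroup = solve (k ∷ q ∷ m ∷ e ∷ [])

prime⇒sieve : ∀ {d} → 7 < d → ∀ k → T (does (prime? (suc k * d + 1))) → T (sieve (d % 3) (d % 5) (d % 7) (suc k))
prime⇒sieve {d} 7<d k is-prime =
  Equivalence.from T-∧ (excluded 3 3≤7 , Equivalence.from T-∧ (excluded 5 5≤7 , excluded 7 ≤-refl))
  where
  p-prime : Prime (suc k * d + 1)
  p-prime = does⇒witness (prime? (suc k * d + 1)) is-prime
    where
    does⇒witness : ∀ {A : Set} (a? : Dec A) → T (does a?) → A
    does⇒witness (yes a) _ = a

  7<p : 7 < suc k * d + 1
  7<p = <-≤-trans 7<d (≤-trans (m≤m+n d (k * d)) (m≤m+n (suc k * d) 1))

  excluded : ∀ m .{{_ : NonZero m}} {{_ : NonTrivial m}} → m ≤ 7 → T (m ∤ᵇ (suc k * (d % m) + 1))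
  excluded m m≤7 = subst T (∤ᵇ-residue m (suc k) d) (prime⇒∤ᵇ m (≤-<-trans m≤7 7<p) p-prime)

  3≤7 : 3 ≤ 7
  3≤7 = s≤s (s≤s (s≤s z≤n))

  5≤7 : 5 ≤ 7
  5≤7 = s≤s (s≤s (s≤s (s≤s (s≤s z≤n))))

SieveBound : ℕ → ℕ → ℕ → Set
SieveBound a b c =
  (100 * count (sieve a b c) 105 ≤ 46 * 105) ×
  (∀ {n} → n < 105 → 100 * count (sieve a b c) n ≤ 46 * n + 700)

sieveBound-nonzero-residues : ∀ {a} → a < 3 → ∀ {b} → b < 5 → ∀ {c} → c < 7 →
  0 < a → 0 < b → 0 < c → SieveBound a b c
sieveBound-nonzero-residues = toWitness {a? = allUpTo? (λ a → allUpTo? (λ b → allUpTo? (λ c →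
  (0 <? a) →-dec (0 <? b) →-dec (0 <? c) →-dec
  ((100 * count (sieve a b c) 105 ≤? 46 * 105) ×-dec
   allUpTo? (λ n → 100 * count (sieve a b c) n ≤? 46 * n + 700) 105)) 7) 5) 3} tt

sieveBound⇒count-bound : ∀ a b c → SieveBound a b c → ∀ n → 100 * count (sieve a b c) n ≤ 46 * n + 700
sieveBound⇒count-bound a b c (period-bound , initial-bound) =
  periodic⇒count-bound 105 {A = 100} {46} {700} (sieve-periodic a b c) period-bound (λ {n} → initial-bound {n})

lemma5p2 : ∀ (d n : ℕ) → 7 < d → Coprime d 3 → Coprime d 5 → Coprime d 7 → 1 ≤ n →
    100 * primeCount d n ≤ 46 * n + 700
lemma5p2 d n 7<d d⊥3 d⊥5 d⊥7 _ = begin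
  100 * primeCount d n                                        ≡⟨ cong (100 *_) (primeCount≡count d n) ⟩
  100 * count (λ k → does (prime? (k * d + 1))) n             ≤⟨ *-monoʳ-≤ 100 (count-mono (prime⇒sieve 7<d) n) ⟩
  100 * count (sieve (d % 3) (d % 5) (d % 7)) n               ≤⟨ sieveBound⇒count-bound (d % 3) (d % 5) (d % 7) residues-bound n ⟩
  46 * n + 700                                                ∎
  where
  open ≤-Reasoning
  residues-bound : SieveBound (d % 3) (d % 5) (d % 7)
  residues-bound = sieveBound-nonzero-residues (m%n<n d 3) (m%n<n d 5) (m%n<n d 7)
    (coprime⇒%-positive d 3 d⊥3) (coprime⇒%-positive d 5 d⊥5) (coprime⇒%-positive d 7 d⊥7)
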